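{- Let $N$ be a positive integer and $M=2N$. Let $\mathbf{v}=v_0v_1\cdots$ be defined by $v_n=2^{\,n\bmod M}$ if $n\not\equiv-1\pmod M$ and $v_n=1-2^{M-1}$ otherwise. Let $\mathbf{u}=u_0u_1\cdots$ be an infinite binary word having positions $n_0,n_1,n_2,\dots$ with $iN\le n_i<(i+1)N$ for all $i\ge0$, such that each position $n_i$ avoids Abelian squares in $\mathbf{u}$. Let $\mathbf{w}=w_0w_1\cdots$ with $w_n=u_n\cdot2^M+v_n$, and define $\mathbf{z}=z_0z_1\cdots$ by $z_i=w_{n_i}+w_{n_i+1}+\cdots+w_{n_{i+1}-1}$. Then $\mathbf{z}$ (an infinite word over a finite set of integers) satisfies the PVHH property.
   Context: An infinite word over a finite set of integers has the PVHH property if it has no factor $xy$ with $|x|=|y|\ge1$ and $\sum x=\sum y$, where $\sum x$ is the sum of the letters of $x$. Two binary words are Abelian equivalent if they have the same numbers of $0$s and $1$s; an Abelian square is $uv$ with $u,v$ nonempty and Abelian equivalent. A position $p$ of $\mathbf{u}$ avoids Abelian squares if the suffix $u_pu_{p+1}\cdots$ has no prefix that is an Abelian square. -}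

module Defs where

open import Data.Nat using (ℕ; zero; suc; _+_; _*_; _∸_; _^_; _%_; _≡ᵇ_; NonZero)
open import Data.Nat.Properties using (m*n≢0)
open import Data.Fin using (Fin; toℕ)
open import Data.Fin.Properties using () renaming (_≟_ to _≟ᶠ_)
open import Data.Integer using (ℤ; +_; _-_) renaming (_+_ to _+ℤ_; _*_ to _*ℤ_)
open import Data.Bool using (if_then_else_)
open import Data.Product using (_×_)
open import Relation.Binary.PropositionalEquality using (_≡_; _≢_)
open import Relation.Nullary using (¬_; yes; no)

count : (ℕ → Fin 2) → Fin 2 → ℕ → ℕ → ℕ
count u b a zero = 0
count u b a (suc k) with u a ≟ᶠ b
... | yes _ = suc (count u b (suc a) k)
... | no  _ = count u b (suc a) k

AbelianEquiv : (ℕ → Fin 2) → ℕ → ℕ → ℕ → ℕ → Set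
AbelianEquiv u a k c l =
  (count u Fin.zero a k ≡ count u Fin.zero c l) × (count u (Fin.suc Fin.zero) a k ≡ count u (Fin.suc Fin.zero) c l)

AvoidsAbelianSquares : (ℕ → Fin 2) → ℕ → Set
AvoidsAbelianSquares u p =
  ∀ k l → ¬ (AbelianEquiv u p (suc k) (p + suc k) (suc l))

sumℤ : (ℕ → ℤ) → ℕ → ℕ → ℤ
sumℤ f a zero = + 0
sumℤ f a (suc k) = f a +ℤ sumℤ f (suc a) k

PVHH : (ℕ → ℤ) → Set
PVHH z = ∀ i k → sumℤ z i (suc k) ≢ sumℤ z (i + suc k) (suc k)

vWord : (N : ℕ) → .{{NonZero N}} → ℕ → ℤ
vWord N n =
  let M = 2 * N
      r = _%_ n M {{m*n≢0 2 N}}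
  in if r ≡ᵇ (M ∸ 1) then + 1 - + (2 ^ (M ∸ 1)) else + (2 ^ r)

wWord : (N : ℕ) → .{{NonZero N}} → (ℕ → Fin 2) → ℕ → ℤ
wWord N u n = (+ toℕ (u n)) *ℤ (+ (2 ^ (2 * N))) +ℤ vWord N n

zWord : (N : ℕ) → .{{NonZero N}} → (ℕ → Fin 2) → (ℕ → ℕ) → ℕ → ℤ
zWord N u n i = sumℤ (wWord N u) (n i) (n (suc i) ∸ n i)

-- Write M = 2N, P = 2^M and F(a) = 2^(a mod M).  The weights v are designed so
-- that v_a + F(a) = F(a+1); hence w_a + F(a) = u_a·P + F(a+1), and summing
-- (telescoping) gives, for every factor w[a, b),
--     Σ w[a, b) + F(a) = (#1s of u[a, b))·P + F(b).                        (*)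
-- A sum of consecutive letters of z is a sum of w over [n_i, n_j).  If two
-- adjacent blocks z[i, j) and z[j, j+k+1) (j = i+k+1) had equal sums, then with
-- a = n_i, b = n_j, c = n_(j+k+1), (*) gives  A·P + (F b + F b) = A'·P + (F c + F a),
-- whose "digits" lie in [1, P]; so A = A' and F a + F c = 2 F b, which forces
-- a ≡ b ≡ c (mod M).  Since the positions lie in windows of width N, the gaps
-- b - a and c - b are then both (k+1)N, so u[a, b) u[b, c) is an Abelian square
-- starting at the position n_i, a contradiction.  Finiteness of the alphabet
-- also follows from (*): z_i = A·P + F(n_(i+1)) - F(n_i) with 0 ≤ A < M.
module Submission where

open import Defs
open import Data.Nat
  using (ℕ; zero; suc; _+_; _*_; _∸_; _^_; _%_; _/_; _≡ᵇ_; _≤_; _<_; s≤s; s≤s⁻¹; NonZero)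
open import Data.Nat.Properties
open import Data.Nat.DivMod
  using (m≡m%n+[m/n]*n; %-distribˡ-+; m%n%n≡m%n; m%n<n; n%n≡0; m<n⇒m%n≡m)
import Data.Nat.Tactic.RingSolver as ℕ-Ring
open import Data.Fin using (Fin; toℕ) renaming (zero to fzero; suc to fsuc)
open import Data.Fin.Properties using () renaming (_≟_ to _≟ᶠ_)
open import Data.Integer using (ℤ; +_) renaming (_+_ to _+ℤ_; _*_ to _*ℤ_; _-_ to _-ℤ_)
import Data.Integer.Properties as ℤ
import Data.Integer.Tactic.RingSolver as ℤ-Ring
open import Data.Bool using (true; false; T; if_then_else_)
open import Data.Unit using (tt)
open import Data.List using (List; map; upTo)
open import Data.List.Membership.Propositional using (_∈_)
open import Data.List.Membership.Propositional.Properties using (∈-map⁺; ∈-upTo⁺)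
open import Data.Product using (Σ; _×_; _,_; proj₁; proj₂)
open import Data.Empty using (⊥-elim; ⊥-elim-irr)
open import Relation.Binary.PropositionalEquality
open import Relation.Binary.Definitions using (tri<; tri≈; tri>)
open import Relation.Nullary using (yes; no; contradiction)

-- A sum of two powers of two is a power of two only as 2^t + 2^t = 2^(t+1).
-- This is what forces the three positions a, b, c to be congruent mod M.
powers-of-two : ∀ r s t → 2 ^ r + 2 ^ s ≡ 2 ^ suc t → r ≡ t × s ≡ t
powers-of-two zero    zero    zero    _ = refl , refl
powers-of-two zero    zero    (suc t) e =
  ⊥-elim (even≢odd (2 ^ t) 0 (sym (*-cancelˡ-≡ 1 (2 * 2 ^ t) 2 e)))
powers-of-two zero    (suc s) t       e = ⊥-elim (even≢odd (2 ^ t) (2 ^ s) (sym e))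
powers-of-two (suc r) zero    t       e =
  ⊥-elim (even≢odd (2 ^ t) (2 ^ r) (sym (trans (+-comm 1 (2 * 2 ^ r)) e)))
powers-of-two (suc r) (suc s) zero    e =
  contradiction (subst (4 ≤_) e four≤) λ { (s≤s (s≤s ())) }
  where
  four≤ : 4 ≤ 2 * 2 ^ r + 2 * 2 ^ s
  four≤ = +-mono-≤ (*-monoʳ-≤ 2 (m^n>0 2 r)) (*-monoʳ-≤ 2 (m^n>0 2 s))
powers-of-two (suc r) (suc s) (suc t) e
  with powers-of-two r s t (*-cancelˡ-≡ _ _ 2 (trans (*-distribˡ-+ 2 (2 ^ r) (2 ^ s)) e))
... | r≡t , s≡t = cong suc r≡t , cong suc s≡t

leading-digit-< : ∀ {A B} P x y → A < B → x ≤ P → 1 ≤ y → A * P + x < B * P + y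
leading-digit-< {A} {B} P x y A<B x≤P 1≤y = begin-strict
  A * P + x      ≤⟨ +-monoʳ-≤ (A * P) x≤P ⟩
  A * P + P      ≡⟨ +-comm (A * P) P ⟩
  suc A * P      <⟨ m<m+n (suc A * P) 1≤y ⟩
  suc A * P + y  ≤⟨ +-monoˡ-≤ y (*-monoˡ-≤ P A<B) ⟩
  B * P + y      ∎
  where open ≤-Reasoning

digits-unique : ∀ A B P x y → A * P + x ≡ B * P + y →
                1 ≤ x → x ≤ P → 1 ≤ y → y ≤ P → A ≡ B × x ≡ y
digits-unique A B P x y e 1≤x x≤P 1≤y y≤P with <-cmp A B
... | tri< A<B _ _ = contradiction e (<⇒≢ (leading-digit-< P x y A<B x≤P 1≤y))
... | tri> _ _ B<A = contradiction (sym e) (<⇒≢ (leading-digit-< P y x B<A y≤P 1≤x))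
... | tri≈ _ refl _ = refl , +-cancelˡ-≡ (A * P) x y e

sumℤ-split : ∀ f a p q → sumℤ f a (p + q) ≡ sumℤ f a p +ℤ sumℤ f (a + p) q
sumℤ-split f a zero    q rewrite +-identityʳ a = sym (ℤ.+-identityˡ _)
sumℤ-split f a (suc p) q rewrite sumℤ-split f (suc a) p q | +-suc a p =
  sym (ℤ.+-assoc (f a) _ _)

sumℤ-concat : ∀ f {a b c} → a ≤ b → b ≤ c →
              sumℤ f a (b ∸ a) +ℤ sumℤ f b (c ∸ b) ≡ sumℤ f a (c ∸ a)
sumℤ-concat f {a} {b} {c} a≤b b≤c = begin
  sumℤ f a (b ∸ a) +ℤ sumℤ f b (c ∸ b)
    ≡⟨ cong (λ x → sumℤ f a (b ∸ a) +ℤ sumℤ f x (c ∸ b)) (m+[n∸m]≡n a≤b) ⟨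
  sumℤ f a (b ∸ a) +ℤ sumℤ f (a + (b ∸ a)) (c ∸ b)
    ≡⟨ sym (sumℤ-split f a (b ∸ a) (c ∸ b)) ⟩
  sumℤ f a ((b ∸ a) + (c ∸ b))
    ≡⟨ cong (sumℤ f a) length ⟩
  sumℤ f a (c ∸ a) ∎
  where
  open ≡-Reasoning
  length : (b ∸ a) + (c ∸ b) ≡ c ∸ a
  length = trans (sym (+-∸-comm (c ∸ b) a≤b)) (cong (_∸ a) (m+[n∸m]≡n b≤c))

nondecreasing : (n : ℕ → ℕ) → (∀ i → n i ≤ n (suc i)) → ∀ i K → n i ≤ n (i + K)
nondecreasing n step i zero    rewrite +-identityʳ i = ≤-refl
nondecreasing n step i (suc K) rewrite +-suc i K =
  ≤-trans (step i) (nondecreasing n step (suc i) K)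

sumℤ-blocks : ∀ f (n : ℕ → ℕ) (step : ∀ i → n i ≤ n (suc i)) i K →
              sumℤ (λ j → sumℤ f (n j) (n (suc j) ∸ n j)) i K
                ≡ sumℤ f (n i) (n (i + K) ∸ n i)
sumℤ-blocks f n step i zero rewrite +-identityʳ i | n∸n≡0 (n i) = refl
sumℤ-blocks f n step i (suc K) rewrite sumℤ-blocks f n step (suc i) K | +-suc i K =
  sumℤ-concat f (step i) (nondecreasing n step (suc i) K)

telescope : ∀ (f h g : ℕ → ℤ) → (∀ t → f t +ℤ g t ≡ h t +ℤ g (suc t)) →
            ∀ a l → sumℤ f a l +ℤ g a ≡ sumℤ h a l +ℤ g (a + l)
telescope f h g step a zero = cong (λ x → + 0 +ℤ g x) (sym (+-identityʳ a))
telescope f h g step a (suc l) = begin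
  (f a +ℤ Σf) +ℤ g a                ≡⟨ exchange (f a) Σf (g a) ⟩
  (f a +ℤ g a) +ℤ Σf                ≡⟨ cong (_+ℤ Σf) (step a) ⟩
  (h a +ℤ g (suc a)) +ℤ Σf          ≡⟨ regroup (h a) (g (suc a)) Σf ⟩
  h a +ℤ (Σf +ℤ g (suc a))          ≡⟨ cong (h a +ℤ_) (telescope f h g step (suc a) l) ⟩
  h a +ℤ (Σh +ℤ g (suc (a + l)))    ≡⟨ ℤ.+-assoc (h a) Σh _ ⟨
  (h a +ℤ Σh) +ℤ g (suc (a + l))    ≡⟨ cong (λ x → (h a +ℤ Σh) +ℤ g x) (+-suc a l) ⟨
  (h a +ℤ Σh) +ℤ g (a + suc l)      ∎
  where
  open ≡-Reasoning
  Σf Σh : ℤ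
  Σf = sumℤ f (suc a) l
  Σh = sumℤ h (suc a) l
  exchange : ∀ x y z → (x +ℤ y) +ℤ z ≡ (x +ℤ z) +ℤ y
  exchange = ℤ-Ring.solve-∀
  regroup : ∀ x y z → (x +ℤ y) +ℤ z ≡ x +ℤ (z +ℤ y)
  regroup = ℤ-Ring.solve-∀

one : Fin 2
one = fsuc fzero

ones : (ℕ → Fin 2) → ℕ → ℕ → ℕ
ones u = count u one

not-one : (x : Fin 2) → x ≢ one → x ≡ fzero
not-one fzero        _   = refl
not-one (fsuc fzero) x≢1 = ⊥-elim (x≢1 refl)

ones-step : ∀ u a l → ones u a (suc l) ≡ toℕ (u a) + ones u (suc a) l
ones-step u a l with u a ≟ᶠ one
... | yes ua≡1 rewrite ua≡1 = refl
... | no  ua≢1 rewrite not-one (u a) ua≢1 = refl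

zeros+ones : ∀ u a l → count u fzero a l + ones u a l ≡ l
zeros+ones u a zero = refl
zeros+ones u a (suc l) with u a ≟ᶠ fzero | u a ≟ᶠ one
... | yes ua≡0 | yes ua≡1 with () ← trans (sym ua≡0) ua≡1
... | yes _    | no _     = cong suc (zeros+ones u (suc a) l)
... | no _     | yes _    = trans (+-suc _ _) (cong suc (zeros+ones u (suc a) l))
... | no ua≢0  | no ua≢1  = ⊥-elim (ua≢0 (not-one (u a) ua≢1))

ones≤length : ∀ u a l → ones u a l ≤ l
ones≤length u a l = subst (ones u a l ≤_) (zeros+ones u a l) (m≤n+m _ _)

ones⇒abelian : ∀ u a b l → ones u a l ≡ ones u b l → AbelianEquiv u a l b l
ones⇒abelian u a b l same-ones = same-zeros , same-ones
  where
  same-zeros : count u fzero a l ≡ count u fzero b l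
  same-zeros = +-cancelʳ-≡ (ones u a l) _ _
    (trans (zeros+ones u a l)
           (sym (trans (cong (λ x → count u fzero b l + x) same-ones) (zeros+ones u b l))))

sum-of-weighted-letters : ∀ u P a l →
  sumℤ (λ t → + (toℕ (u t) * P)) a l ≡ + (ones u a l * P)
sum-of-weighted-letters u P a zero    = refl
sum-of-weighted-letters u P a (suc l) = begin
  + (toℕ (u a) * P) +ℤ sumℤ (λ t → + (toℕ (u t) * P)) (suc a) l
    ≡⟨ cong (+ (toℕ (u a) * P) +ℤ_) (sum-of-weighted-letters u P (suc a) l) ⟩
  + (toℕ (u a) * P + ones u (suc a) l * P)
    ≡⟨ cong +_ (sym (*-distribʳ-+ P (toℕ (u a)) _)) ⟩
  + ((toℕ (u a) + ones u (suc a) l) * P)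
    ≡⟨ cong (λ x → + (x * P)) (sym (ones-step u a l)) ⟩
  + (ones u a (suc l) * P) ∎
  where open ≡-Reasoning

instance
  double-nonZero : ∀ {N} → .{{NonZero N}} → NonZero (2 * N)
  double-nonZero {N} = m*n≢0 2 N

-- Window boundaries: jN = kN + (i+1)N and (j+1)N = (k+2)N + iN for j = i+k+1.
lower-identity : ∀ k N i → k * N + suc i * N ≡ (i + suc k) * N
lower-identity = ℕ-Ring.solve-∀

upper-identity : ∀ k N i → suc (i + suc k) * N ≡ (2 + k) * N + i * N
upper-identity = ℕ-Ring.solve-∀

window-gap : ∀ N i k {a b} → a ≤ b →
             i * N ≤ a → a < suc i * N →
             (i + suc k) * N ≤ b → b < suc (i + suc k) * N →
             k * N < b ∸ a × b ∸ a < (2 + k) * N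
window-gap N i k {a} {b} a≤b iN≤a a<[i+1]N jN≤b b<[j+1]N =
  +-cancelʳ-< a (k * N) (b ∸ a) lower , +-cancelʳ-< a (b ∸ a) ((2 + k) * N) upper
  where
  open ≤-Reasoning
  b∸a+a : b ∸ a + a ≡ b
  b∸a+a = m∸n+n≡m a≤b
  lower : k * N + a < b ∸ a + a
  lower = begin-strict
    k * N + a          <⟨ +-monoʳ-< (k * N) a<[i+1]N ⟩
    k * N + suc i * N  ≡⟨ lower-identity k N i ⟩
    (i + suc k) * N    ≤⟨ jN≤b ⟩
    b                  ≡⟨ b∸a+a ⟨
    b ∸ a + a          ∎
  upper : b ∸ a + a < (2 + k) * N + a
  upper = begin-strict
    b ∸ a + a                ≡⟨ b∸a+a ⟩
    b                        <⟨ b<[j+1]N ⟩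
    suc (i + suc k) * N      ≡⟨ upper-identity k N i ⟩
    (2 + k) * N + i * N      ≤⟨ +-monoʳ-≤ ((2 + k) * N) iN≤a ⟩
    (2 + k) * N + a          ∎

≡-mod⇒multiple : ∀ M .{{_ : NonZero M}} a b → a ≤ b → a % M ≡ b % M →
                 b ∸ a ≡ (b / M ∸ a / M) * M
≡-mod⇒multiple M a b a≤b a≡b = begin
  b ∸ a
    ≡⟨ cong₂ _∸_ (m≡m%n+[m/n]*n b M) (m≡m%n+[m/n]*n a M) ⟩
  (b % M + b / M * M) ∸ (a % M + a / M * M)
    ≡⟨ cong (λ r → (b % M + b / M * M) ∸ (r + a / M * M)) a≡b ⟩
  (b % M + b / M * M) ∸ (b % M + a / M * M)
    ≡⟨ [m+n]∸[m+o]≡n∸o (b % M) _ _ ⟩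
  b / M * M ∸ a / M * M                     ≡⟨ *-distribʳ-∸ M (b / M) (a / M) ⟨
  (b / M ∸ a / M) * M                       ∎
  where open ≡-Reasoning

even-multiple-between : ∀ N k q → k * N < q * (2 * N) → q * (2 * N) < (2 + k) * N →
                        q * (2 * N) ≡ suc k * N
even-multiple-between N k q lower upper =
  trans q·2N≡2q·N (cong (_* N) (≤-antisym (s≤s⁻¹ 2q<2+k) k<2q))
  where
  q·2N≡2q·N : q * (2 * N) ≡ q * 2 * N
  q·2N≡2q·N = sym (*-assoc q 2 N)
  k<2q : k < q * 2
  k<2q = *-cancelʳ-< N k (q * 2) (subst (k * N <_) q·2N≡2q·N lower)
  2q<2+k : q * 2 < 2 + k
  2q<2+k = *-cancelʳ-< N (q * 2) (2 + k) (subst (_< (2 + k) * N) q·2N≡2q·N upper)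

congruent-window-gap : ∀ N .{{_ : NonZero N}} i k {a b} → a ≤ b →
                       i * N ≤ a → a < suc i * N →
                       (i + suc k) * N ≤ b → b < suc (i + suc k) * N →
                       a % (2 * N) ≡ b % (2 * N) → b ∸ a ≡ suc k * N
congruent-window-gap N i k {a} {b} a≤b iN≤a a<[i+1]N jN≤b b<[j+1]N a≡b
  with window-gap N i k a≤b iN≤a a<[i+1]N jN≤b b<[j+1]N
... | lower , upper = trans gap (even-multiple-between N k q
                        (subst (k * N <_) gap lower) (subst (_< (2 + k) * N) gap upper))
  where
  q : ℕ
  q = b / (2 * N) ∸ a / (2 * N)
  gap : b ∸ a ≡ q * (2 * N)
  gap = ≡-mod⇒multiple (2 * N) a b a≤b a≡b

interval : ℕ → ℕ → List ℤ
interval lo hi = map (λ x → + x -ℤ + lo) (upTo (suc (hi + lo)))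

∈-interval : ∀ {lo hi} z g Y → z +ℤ + g ≡ + Y → g ≤ lo → Y ≤ hi →
             z ∈ interval lo hi
∈-interval {lo} {hi} z g Y z+g≡Y g≤lo Y≤hi =
  subst (_∈ interval lo hi) (sym z≡Y+[lo∸g]-lo)
    (∈-map⁺ (λ x → + x -ℤ + lo) (∈-upTo⁺ (s≤s (+-mono-≤ Y≤hi (m∸n≤m lo g)))))
  where
  shift : ∀ x y r → x ≡ ((x +ℤ y) +ℤ r) -ℤ (y +ℤ r)
  shift = ℤ-Ring.solve-∀
  z≡Y+[lo∸g]-lo : z ≡ + (Y + (lo ∸ g)) -ℤ + lo
  z≡Y+[lo∸g]-lo = trans (shift z (+ g) (+ (lo ∸ g)))
    (cong₂ (λ s t → (s +ℤ + (lo ∸ g)) -ℤ t) z+g≡Y (cong +_ (m+[n∸m]≡n g≤lo)))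

module CyclicWeights (m : ℕ) where

  M : ℕ
  M = suc m

  P : ℕ
  P = 2 ^ M

  F : ℕ → ℕ
  F a = 2 ^ (a % M)

  v : ℕ → ℤ
  v a = if a % M ≡ᵇ m then + 1 -ℤ + 2 ^ m else + F a

  w : (ℕ → Fin 2) → ℕ → ℤ
  w u a = + toℕ (u a) *ℤ + P +ℤ v a

  1≤F : ∀ a → 1 ≤ F a
  1≤F a = m^n>0 2 (a % M)

  F≤2^m : ∀ a → F a ≤ 2 ^ m
  F≤2^m a = ^-monoʳ-≤ 2 (s≤s⁻¹ (m%n<n a M))

  F+F≤P : ∀ a c → F a + F c ≤ P
  F+F≤P a c = subst (F a + F c ≤_) (cong (λ x → 2 ^ m + x) (sym (+-identityʳ (2 ^ m))))
                    (+-mono-≤ (F≤2^m a) (F≤2^m c))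

  F≤P : ∀ a → F a ≤ P
  F≤P a = ≤-trans (m≤m+n (F a) (F a)) (F+F≤P a a)

  suc-mod : ∀ a → suc a % M ≡ suc (a % M) % M
  suc-mod a = begin
    (1 + a) % M               ≡⟨ %-distribˡ-+ 1 a M ⟩
    (1 % M + a % M) % M       ≡⟨ cong (λ r → (1 % M + r) % M) (m%n%n≡m%n a M) ⟨
    (1 % M + a % M % M) % M   ≡⟨ %-distribˡ-+ 1 (a % M) M ⟨
    (1 + a % M) % M           ∎
    where open ≡-Reasoning

  v-step : ∀ a → v a +ℤ + F a ≡ + F (suc a)
  v-step a = trans (cycle (a % M) (m%n<n a M)) (cong (λ r → + 2 ^ r) (sym (suc-mod a)))
    where
    cycle : ∀ r → r < M →
            (if r ≡ᵇ m then + 1 -ℤ + 2 ^ m else + 2 ^ r) +ℤ + 2 ^ r ≡ + 2 ^ (suc r % M)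
    cycle r r<M with r ≡ᵇ m in r≡ᵇm
    ... | true rewrite ≡ᵇ⇒≡ r m (subst T (sym r≡ᵇm) tt) =
      trans (minus-plus (+ 1) (+ 2 ^ m)) (cong (λ x → + 2 ^ x) (sym (n%n≡0 M)))
      where
      minus-plus : ∀ x y → (x -ℤ y) +ℤ y ≡ x
      minus-plus = ℤ-Ring.solve-∀
    ... | false = cong +_ (trans (cong (λ x → 2 ^ r + x) (sym (+-identityʳ (2 ^ r))))
                                 (cong (2 ^_) (sym (m<n⇒m%n≡m (s≤s r<m)))))
      where
      r<m : r < m
      r<m = ≤∧≢⇒< (s≤s⁻¹ r<M) λ r≡m → subst T r≡ᵇm (≡⇒≡ᵇ r m r≡m)

  w-step : ∀ u a → w u a +ℤ + F a ≡ + (toℕ (u a) * P) +ℤ + F (suc a)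
  w-step u a = trans (ℤ.+-assoc (+ toℕ (u a) *ℤ + P) (v a) (+ F a))
                     (cong₂ _+ℤ_ (sym (ℤ.pos-* (toℕ (u a)) P)) (v-step a))

  block-identity : ∀ u {a b} → a ≤ b →
                   sumℤ (w u) a (b ∸ a) +ℤ + F a ≡ + (ones u a (b ∸ a) * P + F b)
  block-identity u {a} {b} a≤b = begin
    sumℤ (w u) a (b ∸ a) +ℤ + F a
      ≡⟨ telescope (w u) weighted-letter (λ t → + F t) (w-step u) a (b ∸ a) ⟩
    sumℤ weighted-letter a (b ∸ a) +ℤ + F (a + (b ∸ a))
      ≡⟨ cong₂ (λ s x → s +ℤ + F x) (sum-of-weighted-letters u P a (b ∸ a))
                                    (m+[n∸m]≡n a≤b) ⟩
    + (ones u a (b ∸ a) * P + F b) ∎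
    where
    open ≡-Reasoning
    weighted-letter : ℕ → ℤ
    weighted-letter t = + (toℕ (u t) * P)

  equal-adjacent-sums : ∀ u {a b c} → a ≤ b → b ≤ c →
    sumℤ (w u) a (b ∸ a) ≡ sumℤ (w u) b (c ∸ b) →
    ones u a (b ∸ a) ≡ ones u b (c ∸ b) × a % M ≡ b % M × c % M ≡ b % M
  equal-adjacent-sums u {a} {b} {c} a≤b b≤c sums-equal =
    proj₁ digits , proj₂ residues , proj₁ residues
    where
    A A′ : ℕ
    A  = ones u a (b ∸ a)
    A′ = ones u b (c ∸ b)
    exchange : ∀ x y z → (x +ℤ y) +ℤ z ≡ (x +ℤ z) +ℤ y
    exchange = ℤ-Ring.solve-∀
    -- (*) for both factors, with the common sum eliminated
    balance : A * P + (F b + F b) ≡ A′ * P + (F c + F a)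
    balance = ℤ.+-injective (begin
      + (A * P + (F b + F b))   ≡⟨ cong +_ (+-assoc (A * P) (F b) (F b)) ⟨
      + (A * P + F b) +ℤ + F b  ≡⟨ cong (_+ℤ + F b) (block-identity u a≤b) ⟨
      (Σ₁ +ℤ + F a) +ℤ + F b    ≡⟨ exchange Σ₁ (+ F a) (+ F b) ⟩
      (Σ₁ +ℤ + F b) +ℤ + F a    ≡⟨ cong (λ s → (s +ℤ + F b) +ℤ + F a) sums-equal ⟩
      (Σ₂ +ℤ + F b) +ℤ + F a    ≡⟨ cong (_+ℤ + F a) (block-identity u b≤c) ⟩
      + (A′ * P + F c) +ℤ + F a ≡⟨ cong +_ (+-assoc (A′ * P) (F c) (F a)) ⟩
      + (A′ * P + (F c + F a))  ∎)
      where
      open ≡-Reasoning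
      Σ₁ Σ₂ : ℤ
      Σ₁ = sumℤ (w u) a (b ∸ a)
      Σ₂ = sumℤ (w u) b (c ∸ b)
    digits : A ≡ A′ × F b + F b ≡ F c + F a
    digits = digits-unique A A′ P (F b + F b) (F c + F a) balance
               (≤-trans (1≤F b) (m≤m+n (F b) (F b))) (F+F≤P b b)
               (≤-trans (1≤F c) (m≤m+n (F c) (F a))) (F+F≤P c a)
    doubling : F b + F b ≡ 2 ^ suc (b % M)
    doubling = cong (λ x → F b + x) (sym (+-identityʳ (F b)))
    residues : c % M ≡ b % M × a % M ≡ b % M
    residues = powers-of-two (c % M) (a % M) (b % M) (trans (sym (proj₂ digits)) doubling)

module Construction (N-1 : ℕ) (u : ℕ → Fin 2) (n : ℕ → ℕ)
  (window : ∀ i → (i * suc N-1 ≤ n i) × (n i < suc i * suc N-1))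
  (avoid : ∀ i → AvoidsAbelianSquares u (n i)) where

  N : ℕ
  N = suc N-1

  -- with M = 2N these are (definitionally) the weights v and w of the theorem
  open CyclicWeights (2 * N ∸ 1)

  z : ℕ → ℤ
  z = zWord N u n

  n-step : ∀ i → n i ≤ n (suc i)
  n-step i = <⇒≤ (<-≤-trans (proj₂ (window i)) (proj₁ (window (suc i))))

  z-factor : ∀ i K → sumℤ z i K ≡ sumℤ (w u) (n i) (n (i + K) ∸ n i)
  z-factor = sumℤ-blocks (w u) n n-step

  -- Adjacent factors of z with equal sums would yield an Abelian square at n_i.
  pvhh : PVHH z
  pvhh i k sums-equal = avoid i _ _ abelian-square
    where
    j a b c L : ℕ
    j = i + suc k
    a = n i
    b = n j
    c = n (j + suc k)
    L = suc k * N
    a≤b : a ≤ b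
    a≤b = nondecreasing n n-step i (suc k)
    b≤c : b ≤ c
    b≤c = nondecreasing n n-step j (suc k)
    decoded : ones u a (b ∸ a) ≡ ones u b (c ∸ b) × a % M ≡ b % M × c % M ≡ b % M
    decoded = equal-adjacent-sums u a≤b b≤c
                (trans (sym (z-factor i (suc k))) (trans sums-equal (z-factor j (suc k))))
    b∸a≡L : b ∸ a ≡ L
    b∸a≡L = congruent-window-gap N i k a≤b (proj₁ (window i)) (proj₂ (window i))
              (proj₁ (window j)) (proj₂ (window j)) (proj₁ (proj₂ decoded))
    c∸b≡L : c ∸ b ≡ L
    c∸b≡L = congruent-window-gap N j k b≤c (proj₁ (window j)) (proj₂ (window j))
              (proj₁ (window (j + suc k))) (proj₂ (window (j + suc k)))
              (sym (proj₂ (proj₂ decoded)))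
    b≡a+L : b ≡ a + L
    b≡a+L = trans (sym (m+[n∸m]≡n a≤b)) (cong (λ x → a + x) b∸a≡L)
    abelian-square : AbelianEquiv u a L (a + L) L
    abelian-square = subst (λ x → AbelianEquiv u a L x L) b≡a+L
      (ones⇒abelian u a b L
        (subst₂ (λ p q → ones u a p ≡ ones u b q) b∸a≡L c∸b≡L (proj₁ decoded)))

  alphabet : List ℤ
  alphabet = interval P (M * P + P)

  -- Each letter is z_i = A·P + F(n_(i+1)) - F(n_i) with A ≤ n_(i+1) - n_i < M.
  letters-bounded : ∀ i → z i ∈ alphabet
  letters-bounded i =
    ∈-interval (z i) (F a) (ones u a (b ∸ a) * P + F b) (block-identity u a≤b) (F≤P a)
               (+-mono-≤ (*-monoˡ-≤ P A≤M) (F≤P b))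
    where
    a b : ℕ
    a = n i
    b = n (suc i)
    a≤b : a ≤ b
    a≤b = n-step i
    next-window : (i + 1) * N ≤ b × b < suc (i + 1) * N
    next-window = subst (λ j → j * N ≤ b × b < suc j * N) (sym (+-comm i 1)) (window (suc i))
    A≤M : ones u a (b ∸ a) ≤ M
    A≤M = ≤-trans (ones≤length u a (b ∸ a))
            (<⇒≤ (proj₂ (window-gap N i 0 a≤b (proj₁ (window i)) (proj₂ (window i))
                                                 (proj₁ next-window) (proj₂ next-window))))

mainTheorem15 : (N : ℕ) → .{{_ : NonZero N}} →
    (u : ℕ → Fin 2) → (n : ℕ → ℕ) →
    (∀ i → (i * N ≤ n i) × (n i < suc i * N)) →
    (∀ i → AvoidsAbelianSquares u (n i)) →
    PVHH (zWord N u n) × (Σ (List ℤ) λ L → ∀ i → zWord N u n i ∈ L)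
-- N = 0 is excluded by the hypothesis NonZero N.
mainTheorem15 zero {{N≢0}} _ _ _ _ = ⊥-elim-irr (NonZero.nonZero N≢0)
mainTheorem15 (suc N-1) u n window avoid = pvhh , alphabet , letters-bounded
  where open Construction N-1 u n window avoid
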